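{- Let $\Gamma$ be a finite simple unweighted digraph of order $n$ with Laplacian matrix $L$, let $Q$ be a restrictor matrix of order $n$, and let $P=QQ^*=I-\frac1n\mathbf{e}\mathbf{e}^T$. Then $Q^*LQ$ is normal if and only if $PL$ is normal.
   Context: The Laplacian is $L=D-A$ with $A$ the adjacency matrix (no loops) and $D$ the diagonal matrix of out-degrees. $\mathbf{e}$ is the all-ones vector of length $n$; a restrictor matrix of order $n$ is an $n\times(n-1)$ matrix with orthonormal columns, each orthogonal to $\mathbf{e}$. -}

module Defs where

open import Level using (Level; _⊔_)
open import Data.Nat using (ℕ; zero; suc)
open import Data.Fin using (Fin)
import Data.Fin as Fin
open import Data.Fin.Properties using () renaming (_≟_ to _≟ᶠ_)
open import Data.Bool using (Bool; true; false; if_then_else_)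
open import Relation.Nullary using (¬_; Dec; yes; no)
open import Relation.Binary.PropositionalEquality using (_≡_)
open import Algebra.Bundles using (CommutativeRing)

record Digraph (n : ℕ) : Set where
  field
    adj    : Fin n → Fin n → Bool
    noLoop : ∀ i → adj i i ≡ false

-- Scalars: a commutative ring with an involution (conjugation) x ↦ x̄,
-- a ring automorphism of order 2.  ℂ (complex conjugation) and ℝ
-- (identity) are instances; Q* is the conjugate transpose.

record Involution {c ℓ : Level} (R : CommutativeRing c ℓ) : Set (c ⊔ ℓ) where
  open CommutativeRing R
  field
    conj       : Carrier → Carrier
    conj-cong  : ∀ {x y} → x ≈ y → conj x ≈ conj y
    conj-+     : ∀ x y → conj (x + y) ≈ conj x + conj y
    conj-*     : ∀ x y → conj (x * y) ≈ conj x * conj y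
    conj-1     : conj 1# ≈ 1#
    conj-invol : ∀ x → conj (conj x) ≈ x

module Matrices {c ℓ : Level} (R : CommutativeRing c ℓ) (ι : Involution R) where
  open CommutativeRing R
  open Involution ι

  Matrix : ℕ → ℕ → Set c
  Matrix m k = Fin m → Fin k → Carrier

  Σ : ∀ {n} → (Fin n → Carrier) → Carrier
  Σ {zero}  f = 0#
  Σ {suc n} f = f Fin.zero + Σ {n} (λ i → f (Fin.suc i))

  _⊗_ : ∀ {m k p} → Matrix m k → Matrix k p → Matrix m p
  (A ⊗ B) i j = Σ (λ t → A i t * B t j)

  _* : ∀ {m k} → Matrix m k → Matrix k m
  (A *) i j = conj (A j i)

  δ : ∀ {n} → Fin n → Fin n → Carrier
  δ i j with i ≟ᶠ j
  ... | yes _ = 1#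
  ... | no  _ = 0#

  I : ∀ {n} → Matrix n n
  I = δ

  _≋_ : ∀ {m k} → Matrix m k → Matrix m k → Set ℓ
  A ≋ B = ∀ i j → A i j ≈ B i j

  IsNormal : ∀ {n} → Matrix n n → Set ℓ
  IsNormal A = (A ⊗ (A *)) ≋ ((A *) ⊗ A)

  e : ∀ {n} → Matrix n 1
  e i _ = 1#

  record IsRestrictor {m : ℕ} (Q : Matrix (suc m) m) : Set ℓ where
    field
      orthonormal : ((Q *) ⊗ Q) ≋ I
      orthToE     : ∀ k → ((e *) ⊗ Q) Fin.zero k ≈ 0#

  indicator : Bool → Carrier
  indicator true  = 1#
  indicator false = 0#

  adjacency : ∀ {n} → Digraph n → Matrix n n
  adjacency Γ i j = indicator (Digraph.adj Γ i j)

  outDegree : ∀ {n} → Digraph n → Fin n → Carrier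
  outDegree Γ i = Σ (adjacency Γ i)

  degreeMatrix : ∀ {n} → Digraph n → Matrix n n
  degreeMatrix Γ i j = δ i j * outDegree Γ i

  laplacian : ∀ {n} → Digraph n → Matrix n n
  laplacian Γ i j = degreeMatrix Γ i j - adjacency Γ i j

-- Write P = Q Q* and M = Q* L Q.  Since Q* Q = I, conjugation X ↦ Q X Q* is
-- multiplicative, commutes with *, and is undone by Y ↦ Q* Y Q, so X is normal
-- iff Q X Q* is.  Every row of L sums to zero and P fixes such rows, so L P = L
-- and hence P L = Q M Q*.
--
-- That P fixes a row x with Σ x = 0 is a statement about the tail Q′ of Q (its
-- rows 1 … m) and the matrix K whose rows are those of Q′ minus the first row of
-- Q: the identities Q* Q = I and e* Q = 0 give Q′* K = I.  Over a commutative
-- ring a one-sided inverse of a square matrix is two-sided (det A · det B = 1,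
-- then the adjugate), so K Q′* = I, which says that x P agrees with x off the
-- first entry; both sum to zero, so x P = x.

module Submission where

open import Defs
open import Level using (Level; _⊔_)
open import Data.Nat using (ℕ; zero; suc)
open import Data.Fin using (Fin; zero; suc; punchIn)
open import Data.Fin.Properties using (suc-injective; punchInᵢ≢i) renaming (_≟_ to _≟ᶠ_)
open import Data.Product using (_×_; _,_; proj₁; proj₂)
import Data.Product as Product
open import Data.Vec.Functional using (_∷_; tail; map; updateAt; insertAt; removeAt)
open import Data.Vec.Functional.Properties
  using (updateAt-updates; updateAt-minimal; updateAt-commutes; map-updateAt)
open import Function using (_∘_; const; case_of_)
open import Function.Bundles using (_⇔_; mk⇔)
open import Function.Construct.Composition using (_⇔-∘_)
open import Relation.Nullary using (Dec; yes; no; contradiction)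
open import Relation.Binary.PropositionalEquality as ≡ using (_≡_; _≢_)
open import Algebra.Bundles using (CommutativeRing)
open import Relation.Binary.Bundles using (Setoid)
import Relation.Binary.Reasoning.Setoid as SetoidReasoning

module LinearAlgebra {c ℓ : Level} (R : CommutativeRing c ℓ) (ι : Involution R) where
  open CommutativeRing R hiding (zero)
  open Involution ι
  open Matrices R ι
  open import Algebra.Properties.Ring ring
    using (-‿distribˡ-*; -‿distribʳ-*; -1*x≈-x; x+x≈x⇒x≈0; x[y-z]≈xy-xz; [y-z]x≈yx-zx)
  open import Algebra.Properties.AbelianGroup +-abelianGroup
    using () renaming (⁻¹-involutive to -‿involutive; ε⁻¹≈ε to -0#≈0#; inverseˡ-unique to -‿uniqueˡ)
  open import Algebra.Properties.Semiring.Sum semiring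
    using (sum; sum-remove; sum-cong-≋; sum-replicate-zero; ∑-distrib-+; ∑-comm; *-distribˡ-sum; *-distribʳ-sum)
  import Algebra.Solver.CommutativeMonoid *-commutativeMonoid as ×-Solver
  open ×-Solver using (_⊕_; _⊜_)
  open import Relation.Binary.Reasoning.Setoid setoid

  conj-0# : conj 0# ≈ 0#
  conj-0# = x+x≈x⇒x≈0 (conj 0#) (trans (sym (conj-+ 0# 0#)) (conj-cong (+-identityʳ 0#)))

  -‿*-‿ : ∀ x y → (- x) * (- y) ≈ x * y
  -‿*-‿ x y = begin
    (- x) * (- y)  ≈⟨ -‿distribˡ-* x (- y) ⟨
    - (x * (- y))  ≈⟨ -‿cong (-‿distribʳ-* x y) ⟨
    - - (x * y)    ≈⟨ -‿involutive (x * y) ⟩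
    x * y          ∎

  x*[y*z]≈y*[x*z] : ∀ x y z → x * (y * z) ≈ y * (x * z)
  x*[y*z]≈y*[x*z] = ×-Solver.solve 3 (λ x y z → x ⊕ (y ⊕ z) ⊜ y ⊕ (x ⊕ z)) refl

  Σ≡sum : ∀ {n} (f : Fin n → Carrier) → Σ f ≡ sum f
  Σ≡sum {zero}  f = ≡.refl
  Σ≡sum {suc n} f = ≡.cong (f zero +_) (Σ≡sum (f ∘ suc))

  Σ-cong : ∀ {n} {f g : Fin n → Carrier} → (∀ i → f i ≈ g i) → Σ f ≈ Σ g
  Σ-cong {f = f} {g} f≈g = begin
    Σ f    ≡⟨ Σ≡sum f ⟩
    sum f  ≈⟨ sum-cong-≋ f≈g ⟩
    sum g  ≡⟨ Σ≡sum g ⟨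
    Σ g    ∎

  Σ-zero : ∀ {n} → Σ {n} (const 0#) ≈ 0#
  Σ-zero {n} = trans (reflexive (Σ≡sum {n} (const 0#))) (sum-replicate-zero n)

  Σ-distrib-+ : ∀ {n} (f g : Fin n → Carrier) → Σ (λ i → f i + g i) ≈ Σ f + Σ g
  Σ-distrib-+ f g = begin
    Σ (λ i → f i + g i)    ≡⟨ Σ≡sum (λ i → f i + g i) ⟩
    sum (λ i → f i + g i)  ≈⟨ ∑-distrib-+ f g ⟩
    sum f + sum g          ≡⟨ ≡.cong₂ _+_ (Σ≡sum f) (Σ≡sum g) ⟨
    Σ f + Σ g              ∎

  *-distribˡ-Σ : ∀ {n} x (f : Fin n → Carrier) → x * Σ f ≈ Σ (λ i → x * f i)
  *-distribˡ-Σ x f = begin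
    x * Σ f                ≡⟨ ≡.cong (x *_) (Σ≡sum f) ⟩
    x * sum f              ≈⟨ *-distribˡ-sum x f ⟩
    sum (λ i → x * f i)    ≡⟨ Σ≡sum (λ i → x * f i) ⟨
    Σ (λ i → x * f i)      ∎

  *-distribʳ-Σ : ∀ {n} x (f : Fin n → Carrier) → Σ f * x ≈ Σ (λ i → f i * x)
  *-distribʳ-Σ x f = begin
    Σ f * x                ≡⟨ ≡.cong (λ y → y * x) (Σ≡sum f) ⟩
    sum f * x              ≈⟨ *-distribʳ-sum x f ⟩
    sum (λ i → f i * x)    ≡⟨ Σ≡sum (λ i → f i * x) ⟨
    Σ (λ i → f i * x)      ∎

  Σ-comm : ∀ {m n} (f : Fin m → Fin n → Carrier) →
           Σ (λ i → Σ (λ j → f i j)) ≈ Σ (λ j → Σ (λ i → f i j))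
  Σ-comm f = begin
    Σ (λ i → Σ (λ j → f i j))      ≈⟨ Σ-as-sum² f ⟩
    sum (λ i → sum (λ j → f i j))  ≈⟨ ∑-comm f ⟩
    sum (λ j → sum (λ i → f i j))  ≈⟨ Σ-as-sum² (λ j i → f i j) ⟨
    Σ (λ j → Σ (λ i → f i j))      ∎
    where
    Σ-as-sum² : ∀ {m n} (g : Fin m → Fin n → Carrier) →
                Σ (λ i → Σ (λ j → g i j)) ≈ sum (λ i → sum (λ j → g i j))
    Σ-as-sum² g = trans (reflexive (Σ≡sum (λ i → Σ (g i)))) (sum-cong-≋ (λ i → reflexive (Σ≡sum (g i))))

  Σ-‿ : ∀ {n} (f : Fin n → Carrier) → Σ (λ i → - f i) ≈ - Σ f
  Σ-‿ f = begin
    Σ (λ i → - f i)        ≈⟨ Σ-cong (λ i → -1*x≈-x (f i)) ⟨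
    Σ (λ i → - 1# * f i)   ≈⟨ *-distribˡ-Σ (- 1#) f ⟨
    - 1# * Σ f             ≈⟨ -1*x≈-x (Σ f) ⟩
    - Σ f                  ∎

  Σ-distrib-- : ∀ {n} (f g : Fin n → Carrier) → Σ (λ i → f i - g i) ≈ Σ f - Σ g
  Σ-distrib-- f g = trans (Σ-distrib-+ f (λ i → - g i)) (+-congˡ (Σ-‿ g))

  conj-Σ : ∀ {n} (f : Fin n → Carrier) → conj (Σ f) ≈ Σ (λ i → conj (f i))
  conj-Σ {zero}  f = conj-0#
  conj-Σ {suc n} f = trans (conj-+ _ _) (+-congˡ (conj-Σ (f ∘ suc)))

  δ-diag : ∀ {n} (i : Fin n) → δ i i ≈ 1#
  δ-diag i with i ≟ᶠ i
  ... | yes _   = refl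
  ... | no i≢i = contradiction ≡.refl i≢i

  δ-off : ∀ {n} {i j : Fin n} → i ≢ j → δ i j ≈ 0#
  δ-off {i = i} {j} i≢j with i ≟ᶠ j
  ... | yes i≡j = contradiction i≡j i≢j
  ... | no _    = refl

  δ-sym : ∀ {n} (i j : Fin n) → δ i j ≈ δ j i
  δ-sym i j = case i ≟ᶠ j of λ where
    (yes ≡.refl) → refl
    (no i≢j)     → trans (δ-off i≢j) (sym (δ-off (i≢j ∘ ≡.sym)))

  δ-suc : ∀ {n} (i j : Fin n) → δ (suc i) (suc j) ≈ δ i j
  δ-suc i j = case i ≟ᶠ j of λ where
    (yes ≡.refl) → trans (δ-diag (suc i)) (sym (δ-diag i))
    (no i≢j)     → trans (δ-off (i≢j ∘ suc-injective)) (sym (δ-off i≢j))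

  Σ-δˡ : ∀ {n} (i : Fin n) (f : Fin n → Carrier) → Σ (λ j → δ i j * f j) ≈ f i
  Σ-δˡ {suc n} i f = begin
    Σ (λ j → δ i j * f j)                      ≡⟨ Σ≡sum (λ j → δ i j * f j) ⟩
    sum (λ j → δ i j * f j)                    ≈⟨ sum-remove (λ j → δ i j * f j) ⟩
    δ i i * f i + sum (λ k → δ i (punchIn i k) * f (punchIn i k))
      ≈⟨ +-cong (*-congʳ (δ-diag i)) (sum-cong-≋ (λ k → *-congʳ (δ-off (punchInᵢ≢i i k ∘ ≡.sym)))) ⟩
    1# * f i + sum (λ k → 0# * f (punchIn i k))
      ≈⟨ +-cong (*-identityˡ (f i)) (sum-cong-≋ (λ k → zeroˡ (f (punchIn i k)))) ⟩
    f i + sum {n} (const 0#)                   ≈⟨ +-congˡ (sum-replicate-zero n) ⟩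
    f i + 0#                                   ≈⟨ +-identityʳ (f i) ⟩
    f i                                        ∎

  Σ-δʳ : ∀ {n} (i : Fin n) (f : Fin n → Carrier) → Σ (λ j → f j * δ j i) ≈ f i
  Σ-δʳ i f = trans (Σ-cong (λ j → trans (*-comm (f j) (δ j i)) (*-congʳ (δ-sym j i)))) (Σ-δˡ i f)

  ≋-refl : ∀ {m k} {A : Matrix m k} → A ≋ A
  ≋-refl i j = refl

  ≋-sym : ∀ {m k} {A B : Matrix m k} → A ≋ B → B ≋ A
  ≋-sym A≋B i j = sym (A≋B i j)

  ≋-trans : ∀ {m k} {A B C : Matrix m k} → A ≋ B → B ≋ C → A ≋ C
  ≋-trans A≋B B≋C i j = trans (A≋B i j) (B≋C i j)

  ≗⇒≋ : ∀ {m k} {A B : Matrix m k} → (∀ i → A i ≡ B i) → A ≋ B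
  ≗⇒≋ A≗B i j = reflexive (≡.cong-app (A≗B i) j)

  ⊗-cong : ∀ {m k p} {A A′ : Matrix m k} {B B′ : Matrix k p} → A ≋ A′ → B ≋ B′ → (A ⊗ B) ≋ (A′ ⊗ B′)
  ⊗-cong A≋A′ B≋B′ i j = Σ-cong (λ t → *-cong (A≋A′ i t) (B≋B′ t j))

  ⊗-congˡ : ∀ {m k p} (A : Matrix m k) {B B′ : Matrix k p} → B ≋ B′ → (A ⊗ B) ≋ (A ⊗ B′)
  ⊗-congˡ A = ⊗-cong (≋-refl {A = A})

  ⊗-congʳ : ∀ {m k p} (B : Matrix k p) {A A′ : Matrix m k} → A ≋ A′ → (A ⊗ B) ≋ (A′ ⊗ B)
  ⊗-congʳ B A≋A′ = ⊗-cong A≋A′ (≋-refl {A = B})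

  ⊗-assoc : ∀ {m k p q} (A : Matrix m k) (B : Matrix k p) (C : Matrix p q) →
            ((A ⊗ B) ⊗ C) ≋ (A ⊗ (B ⊗ C))
  ⊗-assoc A B C i j = begin
    Σ (λ s → Σ (λ t → A i t * B t s) * C s j)    ≈⟨ Σ-cong (λ s → *-distribʳ-Σ (C s j) (λ t → A i t * B t s)) ⟩
    Σ (λ s → Σ (λ t → A i t * B t s * C s j))    ≈⟨ Σ-comm (λ s t → A i t * B t s * C s j) ⟩
    Σ (λ t → Σ (λ s → A i t * B t s * C s j))    ≈⟨ Σ-cong (λ t → Σ-cong (λ s → *-assoc (A i t) (B t s) (C s j))) ⟩
    Σ (λ t → Σ (λ s → A i t * (B t s * C s j)))  ≈⟨ Σ-cong (λ t → *-distribˡ-Σ (A i t) (λ s → B t s * C s j)) ⟨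
    Σ (λ t → A i t * Σ (λ s → B t s * C s j))    ∎

  ⊗-identityˡ : ∀ {m k} (A : Matrix m k) → (I ⊗ A) ≋ A
  ⊗-identityˡ A i j = Σ-δˡ i (λ t → A t j)

  ⊗-identityʳ : ∀ {m k} (A : Matrix m k) → (A ⊗ I) ≋ A
  ⊗-identityʳ A i j = Σ-δʳ j (A i)

  adjoint-cong : ∀ {m k} {A B : Matrix m k} → A ≋ B → (A *) ≋ (B *)
  adjoint-cong A≋B i j = conj-cong (A≋B j i)

  adjoint-involutive : ∀ {m k} (A : Matrix m k) → ((A *) *) ≋ A
  adjoint-involutive A i j = conj-invol (A i j)

  adjoint-⊗ : ∀ {m k p} (A : Matrix m k) (B : Matrix k p) → ((A ⊗ B) *) ≋ ((B *) ⊗ (A *))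
  adjoint-⊗ A B i j = begin
    conj (Σ (λ t → A j t * B t i))          ≈⟨ conj-Σ (λ t → A j t * B t i) ⟩
    Σ (λ t → conj (A j t * B t i))          ≈⟨ Σ-cong (λ t → trans (conj-* (A j t) (B t i)) (*-comm _ _)) ⟩
    Σ (λ t → conj (B t i) * conj (A j t))   ∎

  -- Multilinear and alternating functions of the rows of a matrix

  Row : ℕ → Set c
  Row k = Fin k → Carrier

  infix 4 _≐_
  _≐_ : ∀ {k} → Row k → Row k → Set ℓ
  u ≐ v = ∀ j → u j ≈ v j

  infixl 30 _[_]≔_
  _[_]≔_ : ∀ {m k} → Matrix m k → Fin m → Row k → Matrix m k
  A [ r ]≔ v = updateAt A r (const v)

  []≔-updates : ∀ {m k} (A : Matrix m k) r v → (A [ r ]≔ v) r ≐ v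
  []≔-updates A r v j = reflexive (≡.cong-app (updateAt-updates r A) j)

  []≔-minimal : ∀ {m k} (A : Matrix m k) {r i} v → i ≢ r → (A [ r ]≔ v) i ≐ A i
  []≔-minimal A {r} {i} v i≢r j = reflexive (≡.cong-app (updateAt-minimal i r A i≢r) j)

  ≋-[]≔ : ∀ {m k} {A B : Matrix m k} {r v} → B r ≐ v → (∀ i → i ≢ r → B i ≐ A i) → B ≋ A [ r ]≔ v
  ≋-[]≔ {A = A} {r = r} {v} Br≐v Bi≐Ai i j = case i ≟ᶠ r of λ where
    (yes ≡.refl) → trans (Br≐v j) (sym ([]≔-updates A i v j))
    (no i≢r)     → trans (Bi≐Ai i i≢r j) (sym ([]≔-minimal A v i≢r j))

  []≔-cong : ∀ {m k} {A B : Matrix m k} r {u v} → A ≋ B → u ≐ v → A [ r ]≔ u ≋ B [ r ]≔ v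
  []≔-cong {A = A} r {u} A≋B u≐v = ≋-[]≔
    (λ j → trans ([]≔-updates A r u j) (u≐v j))
    (λ i i≢r j → trans ([]≔-minimal A u i≢r j) (A≋B i j))

  []≔-self : ∀ {m k} (A : Matrix m k) r → A [ r ]≔ A r ≋ A
  []≔-self A r = ≋-sym (≋-[]≔ (λ _ → refl) (λ _ _ _ → refl))

  []≔-comm : ∀ {m k} (A : Matrix m k) {r s} u v → r ≢ s → A [ r ]≔ u [ s ]≔ v ≋ A [ s ]≔ v [ r ]≔ u
  []≔-comm A {r} {s} u v r≢s = ≋-sym (≗⇒≋ (updateAt-commutes r s r≢s A))

  map-[]≔ : ∀ {m k k′} (ψ : Row k → Row k′) (A : Matrix m k) r v → map ψ (A [ r ]≔ v) ≋ map ψ A [ r ]≔ ψ v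
  map-[]≔ ψ A r v = ≗⇒≋ (map-updateAt {f = ψ} {g = const v} (λ _ → ≡.refl) A r)

  ∷-[]≔ : ∀ {m k} (v : Row k) (A : Matrix m k) r u → (v ∷ A [ r ]≔ u) ≋ (v ∷ A) [ suc r ]≔ u
  ∷-[]≔ v A r u zero    j = refl
  ∷-[]≔ v A r u (suc i) j = refl

  swapRows : ∀ {m k} → Matrix m k → Fin m → Fin m → Matrix m k
  swapRows A r s = A [ r ]≔ A s [ s ]≔ A r

  record IsMultilinear {m k} (f : Matrix m k → Carrier) : Set (c ⊔ ℓ) where
    field
      cong  : ∀ {A B} → A ≋ B → f A ≈ f B
      +-row : ∀ A r (u v : Row k) → f (A [ r ]≔ (λ j → u j + v j)) ≈ f (A [ r ]≔ u) + f (A [ r ]≔ v)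
      *-row : ∀ A r x (u : Row k) → f (A [ r ]≔ (λ j → x * u j)) ≈ x * f (A [ r ]≔ u)

    zero-row : ∀ A r → f (A [ r ]≔ const 0#) ≈ 0#
    zero-row A r = begin
      f (A [ r ]≔ const 0#)              ≈⟨ cong ([]≔-cong r ≋-refl (λ _ → sym (zeroˡ 0#))) ⟩
      f (A [ r ]≔ (λ _ → 0# * 0#))       ≈⟨ *-row A r 0# (const 0#) ⟩
      0# * f (A [ r ]≔ const 0#)         ≈⟨ zeroˡ _ ⟩
      0#                                 ∎

    Σ-row : ∀ {n} A r (w : Fin n → Carrier) (V : Fin n → Row k) →
            f (A [ r ]≔ (λ j → Σ (λ t → w t * V t j))) ≈ Σ (λ t → w t * f (A [ r ]≔ V t))
    Σ-row {zero}  A r w V = zero-row A r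
    Σ-row {suc n} A r w V = begin
      f (A [ r ]≔ (λ j → w zero * V zero j + Σ (λ t → w (suc t) * V (suc t) j)))
        ≈⟨ +-row A r _ _ ⟩
      f (A [ r ]≔ (λ j → w zero * V zero j)) + f (A [ r ]≔ (λ j → Σ (λ t → w (suc t) * V (suc t) j)))
        ≈⟨ +-cong (*-row A r (w zero) (V zero)) (Σ-row A r (w ∘ suc) (V ∘ suc)) ⟩
      w zero * f (A [ r ]≔ V zero) + Σ (λ t → w (suc t) * f (A [ r ]≔ V (suc t)))
        ∎

  record IsAlternating {m k} (f : Matrix m k → Carrier) : Set (c ⊔ ℓ) where
    field
      isMultilinear : IsMultilinear f
      equal-rows    : ∀ A {r s} → r ≢ s → A r ≐ A s → f A ≈ 0#

    open IsMultilinear isMultilinear public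

    swapRows-negates : ∀ A {r s} → r ≢ s → f (swapRows A r s) ≈ - f A
    swapRows-negates A {r} {s} r≢s = -‿uniqueˡ (f (B b a)) (f A) (begin
      f (B b a) + f A                                    ≈⟨ +-cong (+-identityʳ _) (+-identityˡ _) ⟨
      (f (B b a) + 0#) + (0# + f A)
        ≈⟨ +-cong (+-congˡ (equal b)) (+-cong (equal a) (cong B-a-b≋A)) ⟨
      (f (B b a) + f (B b b)) + (f (B a a) + f (B a b))  ≈⟨ +-comm _ _ ⟩
      (f (B a a) + f (B a b)) + (f (B b a) + f (B b b))
        ≈⟨ +-cong (+-row (A [ r ]≔ a) s a b) (+-row (A [ r ]≔ b) s a b) ⟨
      f (B a w) + f (B b w)                              ≈⟨ +-first a b w ⟨
      f (B w w)                                          ≈⟨ equal w ⟩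
      0#                                                 ∎)
      where
      a b w : Row k
      a = A r
      b = A s
      w j = a j + b j
      B : Row k → Row k → Matrix m k
      B u v = A [ r ]≔ u [ s ]≔ v
      equal : ∀ u → f (B u u) ≈ 0#
      equal u = equal-rows (A [ r ]≔ u [ s ]≔ u) r≢s
        (λ j → trans ([]≔-minimal (A [ r ]≔ u) u r≢s j)
                 (trans ([]≔-updates A r u j) (sym ([]≔-updates (A [ r ]≔ u) s u j))))
      B-a-b≋A : B a b ≋ A
      B-a-b≋A = ≋-trans ([]≔-cong s ([]≔-self A r) (λ _ → refl)) ([]≔-self A s)
      +-first : ∀ u u′ v → f (B (λ j → u j + u′ j) v) ≈ f (B u v) + f (B u′ v)
      +-first u u′ v = begin
        f (B (λ j → u j + u′ j) v)                        ≈⟨ cong ([]≔-comm A _ v r≢s) ⟩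
        f (A [ s ]≔ v [ r ]≔ (λ j → u j + u′ j))          ≈⟨ +-row (A [ s ]≔ v) r u u′ ⟩
        f (A [ s ]≔ v [ r ]≔ u) + f (A [ s ]≔ v [ r ]≔ u′)
          ≈⟨ +-cong (cong ([]≔-comm A u v r≢s)) (cong ([]≔-comm A u′ v r≢s)) ⟨
        f (B u v) + f (B u′ v)                            ∎

  record IsLinear {k k′} (ψ : Row k → Row k′) : Set (c ⊔ ℓ) where
    field
      cong  : ∀ {u v} → u ≐ v → ψ u ≐ ψ v
      +-hom : ∀ u v → ψ (λ j → u j + v j) ≐ (λ j → ψ u j + ψ v j)
      *-hom : ∀ x u → ψ (λ j → x * u j) ≐ (λ j → x * ψ u j)

  ∷-cong : ∀ {m k} (v : Row k) {A B : Matrix m k} → A ≋ B → (v ∷ A) ≋ (v ∷ B)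
  ∷-cong v A≋B zero    j = refl
  ∷-cong v A≋B (suc i) j = A≋B i j

  ∷-isMultilinear : ∀ {m k} {f : Matrix (suc m) k → Carrier} (v : Row k) →
                    IsMultilinear f → IsMultilinear (λ A → f (v ∷ A))
  ∷-isMultilinear {f = f} v f-ml = record
    { cong  = λ A≋B → cong (∷-cong v A≋B)
    ; +-row = λ A r u w → begin
        f (v ∷ A [ r ]≔ (λ j → u j + w j))                   ≈⟨ cong (∷-[]≔ v A r _) ⟩
        f ((v ∷ A) [ suc r ]≔ (λ j → u j + w j))             ≈⟨ +-row (v ∷ A) (suc r) u w ⟩
        f ((v ∷ A) [ suc r ]≔ u) + f ((v ∷ A) [ suc r ]≔ w)  ≈⟨ +-cong (cong (∷-[]≔ v A r u)) (cong (∷-[]≔ v A r w)) ⟨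
        f (v ∷ A [ r ]≔ u) + f (v ∷ A [ r ]≔ w)              ∎
    ; *-row = λ A r x u → begin
        f (v ∷ A [ r ]≔ (λ j → x * u j))          ≈⟨ cong (∷-[]≔ v A r _) ⟩
        f ((v ∷ A) [ suc r ]≔ (λ j → x * u j))    ≈⟨ *-row (v ∷ A) (suc r) x u ⟩
        x * f ((v ∷ A) [ suc r ]≔ u)              ≈⟨ *-congˡ (cong (∷-[]≔ v A r u)) ⟨
        x * f (v ∷ A [ r ]≔ u)                    ∎
    }
    where open IsMultilinear f-ml

  ∷-isAlternating : ∀ {m k} {f : Matrix (suc m) k → Carrier} (v : Row k) →
                    IsAlternating f → IsAlternating (λ A → f (v ∷ A))
  ∷-isAlternating v f-alt = record
    { isMultilinear = ∷-isMultilinear v isMultilinear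
    ; equal-rows    = λ A r≢s → equal-rows (v ∷ A) (r≢s ∘ suc-injective)
    }
    where open IsAlternating f-alt

  map-isMultilinear : ∀ {m k k′} {f : Matrix m k′ → Carrier} {ψ : Row k → Row k′} →
                      IsLinear ψ → IsMultilinear f → IsMultilinear (λ A → f (map ψ A))
  map-isMultilinear {f = f} {ψ} ψ-lin f-ml = record
    { cong  = λ A≋B → cong (λ i → ψ.cong (A≋B i))
    ; +-row = λ A r u v → begin
        f (map ψ (A [ r ]≔ (λ j → u j + v j)))              ≈⟨ cong (map-[]≔ ψ A r _) ⟩
        f (map ψ A [ r ]≔ ψ (λ j → u j + v j))              ≈⟨ cong ([]≔-cong r ≋-refl (ψ.+-hom u v)) ⟩
        f (map ψ A [ r ]≔ (λ j → ψ u j + ψ v j))            ≈⟨ +-row (map ψ A) r (ψ u) (ψ v) ⟩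
        f (map ψ A [ r ]≔ ψ u) + f (map ψ A [ r ]≔ ψ v)
          ≈⟨ +-cong (cong (map-[]≔ ψ A r u)) (cong (map-[]≔ ψ A r v)) ⟨
        f (map ψ (A [ r ]≔ u)) + f (map ψ (A [ r ]≔ v))     ∎
    ; *-row = λ A r x u → begin
        f (map ψ (A [ r ]≔ (λ j → x * u j)))    ≈⟨ cong (map-[]≔ ψ A r _) ⟩
        f (map ψ A [ r ]≔ ψ (λ j → x * u j))    ≈⟨ cong ([]≔-cong r ≋-refl (ψ.*-hom x u)) ⟩
        f (map ψ A [ r ]≔ (λ j → x * ψ u j))    ≈⟨ *-row (map ψ A) r x (ψ u) ⟩
        x * f (map ψ A [ r ]≔ ψ u)              ≈⟨ *-congˡ (cong (map-[]≔ ψ A r u)) ⟨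
        x * f (map ψ (A [ r ]≔ u))              ∎
    }
    where
    open IsMultilinear f-ml
    module ψ = IsLinear ψ-lin

  map-isAlternating : ∀ {m k k′} {f : Matrix m k′ → Carrier} {ψ : Row k → Row k′} →
                      IsLinear ψ → IsAlternating f → IsAlternating (λ A → f (map ψ A))
  map-isAlternating {ψ = ψ} ψ-lin f-alt = record
    { isMultilinear = map-isMultilinear ψ-lin isMultilinear
    ; equal-rows    = λ A r≢s Ar≐As → equal-rows (map ψ A) r≢s (IsLinear.cong ψ-lin Ar≐As)
    }
    where open IsAlternating f-alt

  clear-rows : ∀ {m k} {g : Matrix m k → Carrier} (z : Row k) → IsMultilinear g →
               (∀ A r → A r ≐ z → g A ≈ 0#) →
               ∀ {X Y} (x : Fin m → Carrier) → (∀ i j → X i j ≈ Y i j + x i * z j) → g X ≈ g Y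
  clear-rows {zero}  z g-ml vanish x X≈Y+xz = IsMultilinear.cong g-ml (λ ())
  clear-rows {suc m} {g = g} z g-ml vanish {X} {Y} x X≈Y+xz = begin
    g X                                                         ≈⟨ cong (≋-[]≔ (X≈Y+xz zero) (λ _ _ _ → refl)) ⟩
    g (X [ zero ]≔ (λ j → Y zero j + x zero * z j))             ≈⟨ +-row X zero (Y zero) _ ⟩
    g (X [ zero ]≔ Y zero) + g (X [ zero ]≔ (λ j → x zero * z j)) ≈⟨ +-congˡ (*-row X zero (x zero) z) ⟩
    g (X [ zero ]≔ Y zero) + x zero * g (X [ zero ]≔ z)         ≈⟨ +-congˡ (*-congˡ (vanish _ zero (λ _ → refl))) ⟩
    g (X [ zero ]≔ Y zero) + x zero * 0#                        ≈⟨ +-congˡ (zeroʳ (x zero)) ⟩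
    g (X [ zero ]≔ Y zero) + 0#                                 ≈⟨ +-identityʳ _ ⟩
    g (X [ zero ]≔ Y zero)                                      ≈⟨ cong (λ { zero j → refl ; (suc i) j → refl }) ⟩
    g (Y zero ∷ tail X)
      ≈⟨ clear-rows z (∷-isMultilinear (Y zero) g-ml) (λ A r → vanish (Y zero ∷ A) (suc r)) (x ∘ suc) (X≈Y+xz ∘ suc) ⟩
    g (Y zero ∷ tail Y)                                         ≈⟨ cong (λ { zero j → refl ; (suc i) j → refl }) ⟩
    g Y                                                         ∎
    where open IsMultilinear g-ml

  -- The determinant, by Laplace expansion along the first row

  sgn : ∀ {n} → Fin n → Carrier
  sgn zero    = 1#
  sgn (suc j) = - sgn j

  -- Opaque: were det {suc m} to unfold into the recursion of Σ, the implicit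
  -- arguments of the congruence lemmas below could no longer be inferred.
  opaque
    signedDot : ∀ {n} → Row n → Row n → Carrier
    signedDot a d = Σ (λ j → sgn j * (a j * d j))

    signedDot≡Σ : ∀ {n} (a d : Row n) → signedDot a d ≡ Σ (λ j → sgn j * (a j * d j))
    signedDot≡Σ a d = ≡.refl

    signedDot-cong : ∀ {n} {a a′ d d′ : Row n} → a ≐ a′ → d ≐ d′ → signedDot a d ≈ signedDot a′ d′
    signedDot-cong a≐a′ d≐d′ = Σ-cong (λ j → *-congˡ (*-cong (a≐a′ j) (d≐d′ j)))

    signedDot-+ˡ : ∀ {n} (u v d : Row n) → signedDot (λ j → u j + v j) d ≈ signedDot u d + signedDot v d
    signedDot-+ˡ u v d = trans
      (Σ-cong (λ j → trans (*-congˡ (distribʳ (d j) (u j) (v j))) (distribˡ (sgn j) _ _)))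
      (Σ-distrib-+ (λ j → sgn j * (u j * d j)) (λ j → sgn j * (v j * d j)))

    signedDot-+ʳ : ∀ {n} (a d e : Row n) → signedDot a (λ j → d j + e j) ≈ signedDot a d + signedDot a e
    signedDot-+ʳ a d e = trans
      (Σ-cong (λ j → trans (*-congˡ (distribˡ (a j) (d j) (e j))) (distribˡ (sgn j) _ _)))
      (Σ-distrib-+ (λ j → sgn j * (a j * d j)) (λ j → sgn j * (a j * e j)))

    signedDot-*ˡ : ∀ {n} x (u d : Row n) → signedDot (λ j → x * u j) d ≈ x * signedDot u d
    signedDot-*ˡ x u d = trans
      (Σ-cong (λ j → trans (*-congˡ (*-assoc x (u j) (d j))) (x*[y*z]≈y*[x*z] (sgn j) x (u j * d j))))
      (sym (*-distribˡ-Σ x (λ j → sgn j * (u j * d j))))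

    signedDot-*ʳ : ∀ {n} x (a d : Row n) → signedDot a (λ j → x * d j) ≈ x * signedDot a d
    signedDot-*ʳ x a d = trans
      (Σ-cong (λ j → trans (*-congˡ (x*[y*z]≈y*[x*z] (a j) x (d j))) (x*[y*z]≈y*[x*z] (sgn j) x (a j * d j))))
      (sym (*-distribˡ-Σ x (λ j → sgn j * (a j * d j))))

    signedDot-‿ʳ : ∀ {n} (a d : Row n) → signedDot a (λ j → - d j) ≈ - signedDot a d
    signedDot-‿ʳ a d = trans
      (Σ-cong (λ j → trans (*-congˡ (sym (-‿distribʳ-* (a j) (d j)))) (sym (-‿distribʳ-* (sgn j) _))))
      (Σ-‿ (λ j → sgn j * (a j * d j)))

    signedDot-zeroʳ : ∀ {n} (a : Row n) → signedDot a (const 0#) ≈ 0#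
    signedDot-zeroʳ {n} a = trans (Σ-cong (λ j → trans (*-congˡ (zeroʳ (a j))) (zeroʳ (sgn j)))) (Σ-zero {n})

  minor : ∀ {m} → Fin (suc m) → Matrix (suc m) (suc m) → Matrix m m
  minor j A = map (λ u → removeAt u j) (tail A)

  det : ∀ {m} → Matrix m m → Carrier
  det {zero}  A = 1#
  det {suc m} A = signedDot (A zero) (λ j → det (minor j A))

  det-cong : ∀ {m} {A B : Matrix m m} → A ≋ B → det A ≈ det B
  det-cong {zero}  A≋B = refl
  det-cong {suc m} A≋B = signedDot-cong (A≋B zero) (λ j → det-cong (λ i k → A≋B (suc i) (punchIn j k)))

  minor-[]≔ : ∀ {m} (A : Matrix (suc m) (suc m)) j r v → minor j (A [ suc r ]≔ v) ≋ minor j A [ r ]≔ removeAt v j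
  minor-[]≔ A j r v = map-[]≔ (λ u → removeAt u j) (tail A) r v

  det-+row : ∀ {m} (A : Matrix m m) r (u v : Row m) →
             det (A [ r ]≔ (λ j → u j + v j)) ≈ det (A [ r ]≔ u) + det (A [ r ]≔ v)
  det-+row {suc m} A zero    u v = signedDot-+ˡ u v (λ j → det (minor j A))
  det-+row {suc m} A (suc r) u v = begin
    det (A [ suc r ]≔ (λ j → u j + v j))
      ≈⟨ signedDot-cong (λ _ → refl) (λ j → det-cong (minor-[]≔ A j r _)) ⟩
    signedDot (A zero) (λ j → det (minor j A [ r ]≔ (λ k → u (punchIn j k) + v (punchIn j k))))
      ≈⟨ signedDot-cong (λ _ → refl) (λ j → det-+row (minor j A) r _ _) ⟩
    signedDot (A zero) (λ j → det (minor j A [ r ]≔ removeAt u j) + det (minor j A [ r ]≔ removeAt v j))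
      ≈⟨ signedDot-+ʳ (A zero) _ _ ⟩
    signedDot (A zero) (λ j → det (minor j A [ r ]≔ removeAt u j))
      + signedDot (A zero) (λ j → det (minor j A [ r ]≔ removeAt v j))
      ≈⟨ +-cong (signedDot-cong (λ _ → refl) (λ j → det-cong (minor-[]≔ A j r u)))
                (signedDot-cong (λ _ → refl) (λ j → det-cong (minor-[]≔ A j r v))) ⟨
    det (A [ suc r ]≔ u) + det (A [ suc r ]≔ v)
      ∎

  det-*row : ∀ {m} (A : Matrix m m) r x (u : Row m) →
             det (A [ r ]≔ (λ j → x * u j)) ≈ x * det (A [ r ]≔ u)
  det-*row {suc m} A zero    x u = signedDot-*ˡ x u (λ j → det (minor j A))
  det-*row {suc m} A (suc r) x u = begin
    det (A [ suc r ]≔ (λ j → x * u j))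
      ≈⟨ signedDot-cong (λ _ → refl) (λ j → det-cong (minor-[]≔ A j r _)) ⟩
    signedDot (A zero) (λ j → det (minor j A [ r ]≔ (λ k → x * u (punchIn j k))))
      ≈⟨ signedDot-cong (λ _ → refl) (λ j → det-*row (minor j A) r x _) ⟩
    signedDot (A zero) (λ j → x * det (minor j A [ r ]≔ removeAt u j))
      ≈⟨ signedDot-*ʳ x (A zero) _ ⟩
    x * signedDot (A zero) (λ j → det (minor j A [ r ]≔ removeAt u j))
      ≈⟨ *-congˡ (signedDot-cong (λ _ → refl) (λ j → det-cong (minor-[]≔ A j r u))) ⟨
    x * det (A [ suc r ]≔ u)
      ∎

  det-isMultilinear : ∀ {m} → IsMultilinear (det {m})
  det-isMultilinear = record { cong = det-cong ; +-row = det-+row ; *-row = det-*row }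

  -- (j , l) encodes the ordered pair of distinct columns (j , punchIn j l);
  -- swapPair exchanges the two columns.
  swapPair : ∀ {k} → Fin (suc (suc k)) → Fin (suc k) → Fin (suc (suc k)) × Fin (suc k)
  swapPair zero    l       = suc l , zero
  swapPair (suc j) zero    = zero , j
  swapPair {suc k} (suc j) (suc l) = Product.map suc suc (swapPair j l)

  swapPair-fst : ∀ {k} (j : Fin (suc (suc k))) l → proj₁ (swapPair j l) ≡ punchIn j l
  swapPair-fst zero    l       = ≡.refl
  swapPair-fst (suc j) zero    = ≡.refl
  swapPair-fst {suc k} (suc j) (suc l) = ≡.cong suc (swapPair-fst j l)

  swapPair-punchIn : ∀ {k} (j : Fin (suc (suc k))) l → Product.uncurry punchIn (swapPair j l) ≡ j
  swapPair-punchIn zero    l       = ≡.refl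
  swapPair-punchIn (suc j) zero    = ≡.refl
  swapPair-punchIn {suc k} (suc j) (suc l) = ≡.cong suc (swapPair-punchIn j l)

  swapPair-punchIn² : ∀ {k} (j : Fin (suc (suc k))) l x →
                      punchIn (proj₁ (swapPair j l)) (punchIn (proj₂ (swapPair j l)) x) ≡ punchIn j (punchIn l x)
  swapPair-punchIn² zero    l       x       = ≡.refl
  swapPair-punchIn² (suc j) zero    x       = ≡.refl
  swapPair-punchIn² {suc k} (suc j) (suc l) zero    = ≡.refl
  swapPair-punchIn² {suc k} (suc j) (suc l) (suc x) = ≡.cong suc (swapPair-punchIn² j l x)

  swapPair-sgn : ∀ {k} (j : Fin (suc (suc k))) l →
                 sgn (proj₁ (swapPair j l)) * sgn (proj₂ (swapPair j l)) ≈ - (sgn j * sgn l)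
  swapPair-sgn zero    l       = trans (*-identityʳ (- sgn l)) (-‿cong (sym (*-identityˡ (sgn l))))
  swapPair-sgn (suc j) zero    = begin
    1# * sgn j            ≈⟨ *-identityˡ (sgn j) ⟩
    sgn j                 ≈⟨ -‿involutive (sgn j) ⟨
    - (- sgn j)           ≈⟨ -‿cong (*-identityʳ (- sgn j)) ⟨
    - ((- sgn j) * 1#)    ∎
  swapPair-sgn {suc k} (suc j) (suc l) = begin
    (- sgn j′) * (- sgn l′)      ≈⟨ -‿*-‿ (sgn j′) (sgn l′) ⟩
    sgn j′ * sgn l′              ≈⟨ swapPair-sgn j l ⟩
    - (sgn j * sgn l)            ≈⟨ -‿cong (-‿*-‿ (sgn j) (sgn l)) ⟨
    - ((- sgn j) * (- sgn l))    ∎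
    where
    j′ = proj₁ (swapPair j l)
    l′ = proj₂ (swapPair j l)

  Σ²-swapPair-antisym : ∀ {k} (t : Fin (suc (suc k)) → Fin (suc k) → Carrier) →
                        (∀ j l → Product.uncurry t (swapPair j l) ≈ - t j l) →
                        Σ (λ j → Σ (t j)) ≈ 0#
  Σ²-swapPair-antisym {k} t t-antisym = begin
    Σ (t zero) + Σ (λ j → t (suc j) zero + Σ (λ l → t (suc j) (suc l)))
      ≈⟨ +-congˡ (Σ-distrib-+ (λ j → t (suc j) zero) (λ j → Σ (λ l → t (suc j) (suc l)))) ⟩
    Σ (t zero) + (Σ (λ j → t (suc j) zero) + Σ (λ j → Σ (λ l → t (suc j) (suc l))))
      ≈⟨ +-assoc _ _ _ ⟨
    (Σ (t zero) + Σ (λ j → t (suc j) zero)) + Σ (λ j → Σ (λ l → t (suc j) (suc l)))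
      ≈⟨ +-congʳ (Σ-distrib-+ (t zero) (λ j → t (suc j) zero)) ⟨
    Σ (λ l → t zero l + t (suc l) zero) + Σ (λ j → Σ (λ l → t (suc j) (suc l)))
      ≈⟨ +-cong (trans (Σ-cong (λ l → trans (+-congˡ (t-antisym zero l)) (-‿inverseʳ (t zero l)))) (Σ-zero {suc k}))
                (inner k t t-antisym) ⟩
    0# + 0#
      ≈⟨ +-identityʳ 0# ⟩
    0# ∎
    where
    inner : ∀ k (t : Fin (suc (suc k)) → Fin (suc k) → Carrier) →
            (∀ j l → Product.uncurry t (swapPair j l) ≈ - t j l) →
            Σ (λ j → Σ (λ l → t (suc j) (suc l))) ≈ 0#
    inner zero    t t-antisym = Σ-zero {1}
    inner (suc k) t t-antisym = Σ²-swapPair-antisym (λ j l → t (suc j) (suc l)) (λ j l → t-antisym (suc j) (suc l))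

  -- Expanding along rows 0 and 1, the terms for the column pairs (j , j′) and
  -- (j′ , j) cancel.
  det-equal-rows-01 : ∀ {k} (A : Matrix (suc (suc k)) (suc (suc k))) → A zero ≐ A (suc zero) → det A ≈ 0#
  det-equal-rows-01 {k} A A₀≐A₁ = begin
    det A                                          ≡⟨ signedDot≡Σ a (λ j → det (minor j A)) ⟩
    Σ (λ j → sgn j * (a j * det (minor j A)))      ≈⟨ Σ-cong {f = λ j → sgn j * (a j * det (minor j A))} expand ⟩
    Σ (λ j → Σ (T j))                              ≈⟨ Σ²-swapPair-antisym T T-antisym ⟩
    0#                                             ∎
    where
    a : Row (suc (suc k))
    a = A zero
    D : Fin (suc (suc k)) → Fin (suc k) → Carrier
    D j l = det (minor l (minor j A))
    T : Fin (suc (suc k)) → Fin (suc k) → Carrier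
    T j l = (sgn j * sgn l) * ((a j * a (punchIn j l)) * D j l)

    expand : ∀ j → sgn j * (a j * det (minor j A)) ≈ Σ (T j)
    expand j = begin
      sgn j * (a j * det (minor j A))
        ≡⟨ ≡.cong (λ x → sgn j * (a j * x)) (signedDot≡Σ (removeAt (A (suc zero)) j) (D j)) ⟩
      sgn j * (a j * Σ (λ l → sgn l * (A (suc zero) (punchIn j l) * D j l)))
        ≈⟨ *-congˡ (*-congˡ (Σ-cong {f = λ l → sgn l * (A (suc zero) (punchIn j l) * D j l)}
                                    (λ l → *-congˡ (*-congʳ (sym (A₀≐A₁ (punchIn j l))))))) ⟩
      sgn j * (a j * Σ (λ l → sgn l * (a (punchIn j l) * D j l)))
        ≈⟨ *-congˡ (*-distribˡ-Σ (a j) (λ l → sgn l * (a (punchIn j l) * D j l))) ⟩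
      sgn j * Σ (λ l → a j * (sgn l * (a (punchIn j l) * D j l)))
        ≈⟨ *-distribˡ-Σ (sgn j) (λ l → a j * (sgn l * (a (punchIn j l) * D j l))) ⟩
      Σ (λ l → sgn j * (a j * (sgn l * (a (punchIn j l) * D j l))))
        ≈⟨ Σ-cong {f = λ l → sgn j * (a j * (sgn l * (a (punchIn j l) * D j l)))}
                  (λ l → regroup (sgn j) (a j) (sgn l) (a (punchIn j l)) (D j l)) ⟩
      Σ (T j)
        ∎
      where
      regroup : ∀ s x s′ y d → s * (x * (s′ * (y * d))) ≈ (s * s′) * ((x * y) * d)
      regroup = ×-Solver.solve 5 (λ s x s′ y d → s ⊕ (x ⊕ (s′ ⊕ (y ⊕ d))) ⊜ (s ⊕ s′) ⊕ ((x ⊕ y) ⊕ d)) refl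

    T-antisym : ∀ j l → Product.uncurry T (swapPair j l) ≈ - T j l
    T-antisym j l = begin
      (sgn j′ * sgn l′) * ((a j′ * a (punchIn j′ l′)) * D j′ l′)
        ≈⟨ *-cong (swapPair-sgn j l)
                  (*-cong (*-cong (reflexive (≡.cong a (swapPair-fst j l)))
                                  (reflexive (≡.cong a (swapPair-punchIn j l))))
                          (det-cong (λ i x → reflexive (≡.cong (A (suc (suc i))) (swapPair-punchIn² j l x))))) ⟩
      - (sgn j * sgn l) * ((a (punchIn j l) * a j) * D j l)
        ≈⟨ -‿distribˡ-* _ _ ⟨
      - ((sgn j * sgn l) * ((a (punchIn j l) * a j) * D j l))
        ≈⟨ -‿cong (*-congˡ (*-congʳ (*-comm (a (punchIn j l)) (a j)))) ⟩
      - T j l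
        ∎
      where
      j′ = proj₁ (swapPair j l)
      l′ = proj₂ (swapPair j l)

  minor-swapRows : ∀ {m} (A : Matrix (suc m) (suc m)) j r s →
                   minor j (swapRows A (suc r) (suc s)) ≋ swapRows (minor j A) r s
  minor-swapRows A j r s =
    ≋-trans (minor-[]≔ (A [ suc r ]≔ A (suc s)) j s (A (suc r)))
            ([]≔-cong s (minor-[]≔ A j r (A (suc s))) (λ _ → refl))

  mutual
    det-isAlternating : ∀ {m} → IsAlternating (det {m})
    det-isAlternating = record { isMultilinear = det-isMultilinear ; equal-rows = det-equal-rows }

    det-swapRows-suc : ∀ {m} (A : Matrix (suc m) (suc m)) {r s} → r ≢ s →
                       det (swapRows A (suc r) (suc s)) ≈ - det A
    det-swapRows-suc A {r} {s} r≢s = begin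
      det (swapRows A (suc r) (suc s))
        ≈⟨ signedDot-cong (λ _ → refl) (λ j → det-cong (minor-swapRows A j r s)) ⟩
      signedDot (A zero) (λ j → det (swapRows (minor j A) r s))
        ≈⟨ signedDot-cong (λ _ → refl) (λ j → IsAlternating.swapRows-negates det-isAlternating (minor j A) r≢s) ⟩
      signedDot (A zero) (λ j → - det (minor j A))
        ≈⟨ signedDot-‿ʳ (A zero) (λ j → det (minor j A)) ⟩
      - det A
        ∎

    det-equal-rows : ∀ {m} (A : Matrix m m) {r s} → r ≢ s → A r ≐ A s → det A ≈ 0#
    det-equal-rows {suc m} A {zero}  {zero}  0≢0 _     = contradiction ≡.refl 0≢0
    det-equal-rows {suc m} A {zero}  {suc s} _   A₀≐Aₛ = det-equal-rows-0 A s A₀≐Aₛ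
    det-equal-rows {suc m} A {suc r} {zero}  _   Aᵣ≐A₀ = det-equal-rows-0 A r (λ j → sym (Aᵣ≐A₀ j))
    det-equal-rows {suc m} A {suc r} {suc s} r≢s Aᵣ≐Aₛ = begin
      det A
        ≈⟨ signedDot-cong (λ _ → refl) (λ j → det-equal-rows (minor j A) (r≢s ∘ ≡.cong suc) (Aᵣ≐Aₛ ∘ punchIn j)) ⟩
      signedDot (A zero) (const 0#)
        ≈⟨ signedDot-zeroʳ (A zero) ⟩
      0# ∎

    det-equal-rows-0 : ∀ {m} (A : Matrix (suc m) (suc m)) s → A zero ≐ A (suc s) → det A ≈ 0#
    det-equal-rows-0 {suc k}       A zero    A₀≐A₁   = det-equal-rows-01 A A₀≐A₁
    -- Swapping rows 1 and s + 2 negates det (inside the minors, by induction)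
    -- and makes rows 0 and 1 equal.
    det-equal-rows-0 {suc (suc k)} A (suc s) A₀≐Aₛ₊₂ = begin
      det A                                        ≈⟨ -‿involutive (det A) ⟨
      - (- det A)                                  ≈⟨ -‿cong (det-swapRows-suc A {zero} {suc s} (λ ())) ⟨
      - det (swapRows A (suc zero) (suc (suc s)))
        ≈⟨ -‿cong (det-equal-rows-01 (swapRows A (suc zero) (suc (suc s))) A₀≐Aₛ₊₂) ⟩
      - 0#                                         ≈⟨ -0#≈0# ⟩
      0#                                           ∎

  -- Uniqueness of the determinant, multiplicativity and the adjugate

  insertZero : ∀ {k} → Fin (suc k) → Row k → Row (suc k)
  insertZero j u = insertAt u j 0#

  insertZero-cong : ∀ {k} (j : Fin (suc k)) {u v : Row k} → u ≐ v → insertZero j u ≐ insertZero j v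
  insertZero-cong zero            u≐v zero    = refl
  insertZero-cong zero            u≐v (suc c) = u≐v c
  insertZero-cong {suc k} (suc j) u≐v zero    = u≐v zero
  insertZero-cong {suc k} (suc j) u≐v (suc c) = insertZero-cong j (u≐v ∘ suc) c

  insertZero-isLinear : ∀ {k} (j : Fin (suc k)) → IsLinear (insertZero j)
  insertZero-isLinear j = record { cong = insertZero-cong j ; +-hom = +-hom j ; *-hom = *-hom j }
    where
    +-hom : ∀ {k} (j : Fin (suc k)) u v → insertZero j (λ c → u c + v c) ≐ (λ c → insertZero j u c + insertZero j v c)
    +-hom zero            u v zero    = sym (+-identityʳ 0#)
    +-hom zero            u v (suc c) = refl
    +-hom {suc k} (suc j) u v zero    = refl
    +-hom {suc k} (suc j) u v (suc c) = +-hom j (tail u) (tail v) c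
    *-hom : ∀ {k} (j : Fin (suc k)) x u → insertZero j (λ c → x * u c) ≐ (λ c → x * insertZero j u c)
    *-hom zero            x u zero    = sym (zeroʳ x)
    *-hom zero            x u (suc c) = refl
    *-hom {suc k} (suc j) x u zero    = refl
    *-hom {suc k} (suc j) x u (suc c) = *-hom j x (tail u) c

  insertZero-const : ∀ {k} (j : Fin (suc k)) → insertZero j (const 0#) ≐ const 0#
  insertZero-const zero            zero    = refl
  insertZero-const zero            (suc c) = refl
  insertZero-const {suc k} (suc j) zero    = refl
  insertZero-const {suc k} (suc j) (suc c) = insertZero-const j c

  insertZero-removeAt : ∀ {k} (w : Row (suc k)) j → w ≐ (λ c → insertZero j (removeAt w j) c + w j * δ j c)
  insertZero-removeAt {k} w zero zero =
    sym (trans (+-identityˡ _) (trans (*-congˡ (δ-diag {suc k} zero)) (*-identityʳ (w zero))))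
  insertZero-removeAt w zero (suc c) = sym (trans (+-congˡ (zeroʳ (w zero))) (+-identityʳ (w (suc c))))
  insertZero-removeAt {suc k} w (suc j) zero = sym (trans (+-congˡ (zeroʳ (w (suc j)))) (+-identityʳ (w zero)))
  insertZero-removeAt {suc k} w (suc j) (suc c) =
    trans (insertZero-removeAt (tail w) j c) (+-congˡ (*-congˡ (sym (δ-suc j c))))

  emb : ∀ {k} → Fin (suc k) → Matrix k k → Matrix (suc k) (suc k)
  emb j M = δ j ∷ map (insertZero j) M

  emb-isAlternating : ∀ {k} {f : Matrix (suc k) (suc k) → Carrier} (j : Fin (suc k)) →
                      IsAlternating f → IsAlternating (λ M → f (emb j M))
  emb-isAlternating j f-alt = map-isAlternating (insertZero-isLinear j) (∷-isAlternating (δ j) f-alt)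

  emb-zero-I : ∀ {k} → emb {k} zero I ≋ I
  emb-zero-I zero    c       = refl
  emb-zero-I (suc i) zero    = refl
  emb-zero-I (suc i) (suc c) = sym (δ-suc i c)

  swapRows-emb-suc-I : ∀ {k} (j : Fin (suc k)) →
                       swapRows (emb (suc j) I) zero (suc zero) ≋ emb zero (emb j I)
  swapRows-emb-suc-I j zero          zero          = refl
  swapRows-emb-suc-I j zero          (suc c)       = insertZero-const j c
  swapRows-emb-suc-I j (suc zero)    zero          = refl
  swapRows-emb-suc-I j (suc zero)    (suc c)       = δ-suc j c
  swapRows-emb-suc-I j (suc (suc i)) zero          = refl
  swapRows-emb-suc-I j (suc (suc i)) (suc c)       = insertZero-cong j (δ-suc i) c

  alternating-emb-I : ∀ {k} {f : Matrix (suc k) (suc k) → Carrier} → IsAlternating f →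
                      ∀ j → f (emb j I) ≈ sgn j * f I
  alternating-emb-I f-alt zero = trans (IsAlternating.cong f-alt emb-zero-I) (sym (*-identityˡ _))
  alternating-emb-I {suc k} {f} f-alt (suc j) = begin
    f (emb (suc j) I)                               ≈⟨ -‿involutive _ ⟨
    - (- f (emb (suc j) I))
      ≈⟨ -‿cong (swapRows-negates (emb (suc j) I) {zero} {suc zero} (λ ())) ⟨
    - f (swapRows (emb (suc j) I) zero (suc zero))   ≈⟨ -‿cong (cong (swapRows-emb-suc-I j)) ⟩
    - f (emb zero (emb j I))                         ≈⟨ -‿cong (alternating-emb-I (emb-isAlternating zero f-alt) j) ⟩
    - (sgn j * f (emb zero I))                       ≈⟨ -‿cong (*-congˡ (cong emb-zero-I)) ⟩
    - (sgn j * f I)                                  ≈⟨ -‿distribˡ-* (sgn j) (f I) ⟩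
    - sgn j * f I                                    ∎
    where open IsAlternating f-alt

  -- Expand row 0 in the standard basis.  Once row 0 is δ j, clear-rows empties
  -- column j of the other rows, leaving f ∘ emb j at the minor, where
  -- induction applies.
  det-unique : ∀ {m} {f : Matrix m m → Carrier} → IsAlternating f → ∀ A → f A ≈ det A * f I
  det-unique {zero}      f-alt A = trans (IsAlternating.cong f-alt (λ ())) (sym (*-identityˡ _))
  det-unique {suc k} {f} f-alt A = begin
    f A
      ≈⟨ cong (≋-[]≔ (λ c → sym (Σ-δʳ c (A zero))) (λ _ _ _ → refl)) ⟩
    f (A [ zero ]≔ (λ c → Σ (λ j → A zero j * δ j c)))
      ≈⟨ Σ-row A zero (A zero) δ ⟩
    Σ (λ j → A zero j * f (A [ zero ]≔ δ j))
      ≈⟨ Σ-cong {f = λ j → A zero j * f (A [ zero ]≔ δ j)} (λ j → *-congˡ (basis-row j)) ⟩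
    Σ (λ j → A zero j * (det (minor j A) * (sgn j * f I)))
      ≈⟨ Σ-cong {f = λ j → A zero j * (det (minor j A) * (sgn j * f I))}
           (λ j → ×-Solver.solve 4 (λ a d s x → a ⊕ (d ⊕ (s ⊕ x)) ⊜ (s ⊕ (a ⊕ d)) ⊕ x) refl
                                   (A zero j) (det (minor j A)) (sgn j) (f I)) ⟩
    Σ (λ j → sgn j * (A zero j * det (minor j A)) * f I)
      ≈⟨ *-distribʳ-Σ (f I) (λ j → sgn j * (A zero j * det (minor j A))) ⟨
    Σ (λ j → sgn j * (A zero j * det (minor j A))) * f I
      ≡⟨ ≡.cong (λ x → x * f I) (signedDot≡Σ (A zero) (λ j → det (minor j A))) ⟨
    det A * f I
      ∎
    where
    open IsAlternating f-alt
    basis-row : ∀ j → f (A [ zero ]≔ δ j) ≈ det (minor j A) * (sgn j * f I)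
    basis-row j = begin
      f (A [ zero ]≔ δ j)              ≈⟨ cong (λ { zero c → refl ; (suc i) c → refl }) ⟩
      f (δ j ∷ tail A)
        ≈⟨ clear-rows (δ j) (∷-isMultilinear (δ j) isMultilinear)
             (λ B r Bᵣ≐δⱼ → equal-rows (δ j ∷ B) {zero} {suc r} (λ ()) (λ c → sym (Bᵣ≐δⱼ c)))
             (λ i → A (suc i) j) (λ i → insertZero-removeAt (A (suc i)) j) ⟩
      f (emb j (minor j A))            ≈⟨ det-unique (emb-isAlternating j f-alt) (minor j A) ⟩
      det (minor j A) * f (emb j I)    ≈⟨ *-congˡ (alternating-emb-I f-alt j) ⟩
      det (minor j A) * (sgn j * f I)  ∎

  det-I : ∀ {m} → det (I {m}) ≈ 1#
  det-I {zero}  = refl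
  det-I {suc m} = begin
    det (I {suc m})                        ≡⟨ signedDot≡Σ (δ zero) d ⟩
    Σ (λ j → sgn j * (δ zero j * d j))     ≈⟨ Σ-cong {f = λ j → sgn j * (δ zero j * d j)}
                                                     (λ j → x*[y*z]≈y*[x*z] (sgn j) (δ zero j) (d j)) ⟩
    Σ (λ j → δ zero j * (sgn j * d j))     ≈⟨ Σ-δˡ zero (λ j → sgn j * d j) ⟩
    1# * d zero                            ≈⟨ *-identityˡ (d zero) ⟩
    d zero                                 ≈⟨ det-cong {B = I {m}} (λ i c → δ-suc i c) ⟩
    det (I {m})                            ≈⟨ det-I {m} ⟩
    1#                                     ∎
    where
    d : Fin (suc m) → Carrier
    d j = det (minor j (I {suc m}))

  rowTimes : ∀ {k p} → Matrix k p → Row k → Row p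
  rowTimes B u t = Σ (λ s → u s * B s t)

  rowTimes-isLinear : ∀ {k p} (B : Matrix k p) → IsLinear (rowTimes B)
  rowTimes-isLinear B = record
    { cong  = λ u≐v t → Σ-cong (λ s → *-congʳ (u≐v s))
    ; +-hom = λ u v t → trans (Σ-cong (λ s → distribʳ (B s t) (u s) (v s)))
                              (Σ-distrib-+ (λ s → u s * B s t) (λ s → v s * B s t))
    ; *-hom = λ x u t → trans (Σ-cong (λ s → *-assoc x (u s) (B s t)))
                              (sym (*-distribˡ-Σ x (λ s → u s * B s t)))
    }

  det-⊗ : ∀ {m} (A B : Matrix m m) → det (A ⊗ B) ≈ det A * det B
  det-⊗ A B = begin
    det (A ⊗ B)          ≈⟨ det-unique (map-isAlternating (rowTimes-isLinear B) det-isAlternating) A ⟩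
    det A * det (I ⊗ B)  ≈⟨ *-congˡ (det-cong (⊗-identityˡ B)) ⟩
    det A * det B        ∎

  adjugate : ∀ {m} → Matrix m m → Matrix m m
  adjugate A j k = det (A [ k ]≔ δ j)

  ⊗-adjugate : ∀ {m} (A : Matrix m m) i k → (A ⊗ adjugate A) i k ≈ det A * δ i k
  ⊗-adjugate A i k = begin
    Σ (λ j → A i j * det (A [ k ]≔ δ j))            ≈⟨ Σ-row A k (A i) δ ⟨
    det (A [ k ]≔ (λ c → Σ (λ j → A i j * δ j c)))  ≈⟨ det-cong ([]≔-cong k ≋-refl (λ c → Σ-δʳ c (A i))) ⟩
    det (A [ k ]≔ A i)                              ≈⟨ case i ≟ᶠ k of replace-row ⟩
    det A * δ i k                                   ∎
    where
    open IsAlternating det-isAlternating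
    replace-row : Dec (i ≡ k) → det (A [ k ]≔ A i) ≈ det A * δ i k
    replace-row (yes ≡.refl) = trans (det-cong ([]≔-self A i)) (sym (trans (*-congˡ (δ-diag i)) (*-identityʳ _)))
    replace-row (no i≢k)     = trans
      (equal-rows (A [ k ]≔ A i) (i≢k ∘ ≡.sym)
        (λ c → trans ([]≔-updates A k (A i) c) (sym ([]≔-minimal A (A i) i≢k c))))
      (sym (trans (*-congˡ (δ-off i≢k)) (zeroʳ _)))

  -- det A · det B = 1, so C = det A · adjugate B is a right inverse of B, and
  -- then A = A (B C) = C.
  rightInverse⇒leftInverse : ∀ {m} {A B : Matrix m m} → (A ⊗ B) ≋ I → (B ⊗ A) ≋ I
  rightInverse⇒leftInverse {m} {A} {B} AB≋I = ≋-trans (⊗-congˡ B A≋C) BC≋I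
    where
    detA*detB≈1 : det A * det B ≈ 1#
    detA*detB≈1 = trans (sym (det-⊗ A B)) (trans (det-cong AB≋I) (det-I {m}))
    C : Matrix m m
    C i k = det A * adjugate B i k
    BC≋I : (B ⊗ C) ≋ I
    BC≋I i k = begin
      Σ (λ t → B i t * (det A * adjugate B t k))
        ≈⟨ Σ-cong (λ t → x*[y*z]≈y*[x*z] (B i t) (det A) (adjugate B t k)) ⟩
      Σ (λ t → det A * (B i t * adjugate B t k))   ≈⟨ *-distribˡ-Σ (det A) (λ t → B i t * adjugate B t k) ⟨
      det A * (B ⊗ adjugate B) i k                 ≈⟨ *-congˡ (⊗-adjugate B i k) ⟩
      det A * (det B * δ i k)                      ≈⟨ *-assoc _ _ _ ⟨
      (det A * det B) * δ i k                      ≈⟨ *-congʳ detA*detB≈1 ⟩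
      1# * δ i k                                   ≈⟨ *-identityˡ _ ⟩
      δ i k                                        ∎
    A≋C : A ≋ C
    A≋C = ≋-trans (≋-sym (⊗-identityʳ A))
          (≋-trans (⊗-congˡ A (≋-sym BC≋I))
          (≋-trans (≋-sym (⊗-assoc A B C))
          (≋-trans (⊗-congʳ C AB≋I) (⊗-identityˡ C))))

  -- Zero-sum rows, Laplacians and restrictors

  head≈-Σtail : ∀ {n} (u : Row (suc n)) → Σ u ≈ 0# → u zero ≈ - Σ (tail u)
  head≈-Σtail u Σu≈0 = -‿uniqueˡ (u zero) (Σ (tail u)) Σu≈0

  zeroSum-tail-≐ : ∀ {n} {u v : Row (suc n)} → Σ u ≈ 0# → Σ v ≈ 0# → (∀ i → u (suc i) ≈ v (suc i)) → u ≐ v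
  zeroSum-tail-≐ {u = u} {v} Σu≈0 Σv≈0 tails zero = begin
    u zero           ≈⟨ head≈-Σtail u Σu≈0 ⟩
    - Σ (tail u)     ≈⟨ -‿cong (Σ-cong tails) ⟩
    - Σ (tail v)     ≈⟨ head≈-Σtail v Σv≈0 ⟨
    v zero           ∎
  zeroSum-tail-≐ Σu≈0 Σv≈0 tails (suc i) = tails i

  Σ-*-zeroSum : ∀ {n} (u w : Row (suc n)) → Σ u ≈ 0# →
                Σ (λ j → u j * w j) ≈ Σ (λ i → u (suc i) * (w (suc i) - w zero))
  Σ-*-zeroSum u w Σu≈0 = begin
    u zero * w zero + Σ (λ i → u (suc i) * w (suc i))
      ≈⟨ +-congʳ (*-congʳ (head≈-Σtail u Σu≈0)) ⟩
    (- Σ (tail u)) * w zero + Σ (λ i → u (suc i) * w (suc i))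
      ≈⟨ +-congʳ (-‿distribˡ-* (Σ (tail u)) (w zero)) ⟨
    - (Σ (tail u) * w zero) + Σ (λ i → u (suc i) * w (suc i))
      ≈⟨ +-congʳ (-‿cong (*-distribʳ-Σ (w zero) (tail u))) ⟩
    - Σ (λ i → u (suc i) * w zero) + Σ (λ i → u (suc i) * w (suc i))
      ≈⟨ +-comm _ _ ⟩
    Σ (λ i → u (suc i) * w (suc i)) - Σ (λ i → u (suc i) * w zero)
      ≈⟨ Σ-distrib-- (λ i → u (suc i) * w (suc i)) (λ i → u (suc i) * w zero) ⟨
    Σ (λ i → u (suc i) * w (suc i) - u (suc i) * w zero)
      ≈⟨ Σ-cong (λ i → x[y-z]≈xy-xz (u (suc i)) (w (suc i)) (w zero)) ⟨
    Σ (λ i → u (suc i) * (w (suc i) - w zero))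
      ∎

  laplacian-rowSum : ∀ {n} (Γ : Digraph n) i → Σ (laplacian Γ i) ≈ 0#
  laplacian-rowSum Γ i = begin
    Σ (λ j → δ i j * outDegree Γ i - adjacency Γ i j)
      ≈⟨ Σ-distrib-- (λ j → δ i j * outDegree Γ i) (adjacency Γ i) ⟩
    Σ (λ j → δ i j * outDegree Γ i) - Σ (adjacency Γ i)            ≈⟨ +-congʳ (Σ-δˡ i (const (outDegree Γ i))) ⟩
    outDegree Γ i - outDegree Γ i                                   ≈⟨ -‿inverseʳ (outDegree Γ i) ⟩
    0#                                                              ∎

  module _ {m} {Q : Matrix (suc m) m} (isRestrictor : IsRestrictor Q) where
    open IsRestrictor isRestrictor

    restrictor-conj-columnSum : ∀ k → Σ (λ t → conj (Q t k)) ≈ 0#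
    restrictor-conj-columnSum k = begin
      Σ (λ t → conj (Q t k))           ≈⟨ conj-Σ (λ t → Q t k) ⟨
      conj (Σ (λ t → Q t k))
        ≈⟨ conj-cong (Σ-cong {f = λ t → conj 1# * Q t k} (λ t → trans (*-congʳ conj-1) (*-identityˡ (Q t k)))) ⟨
      conj (((e *) ⊗ Q) zero k)        ≈⟨ conj-cong (orthToE k) ⟩
      conj 0#                          ≈⟨ conj-0# ⟩
      0#                               ∎

    tailMinusHead : Matrix m m
    tailMinusHead i l = Q (suc i) l - Q zero l

    adjoint-tail-⊗-tailMinusHead : ((tail Q *) ⊗ tailMinusHead) ≋ I
    adjoint-tail-⊗-tailMinusHead k l = begin
      Σ (λ i → conj (Q (suc i) k) * (Q (suc i) l - Q zero l))
        ≈⟨ Σ-*-zeroSum (λ t → conj (Q t k)) (λ t → Q t l) (restrictor-conj-columnSum k) ⟨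
      ((Q *) ⊗ Q) k l
        ≈⟨ orthonormal k l ⟩
      δ k l
        ∎

    projection-rowSum : ∀ j → Σ ((Q ⊗ (Q *)) j) ≈ 0#
    projection-rowSum j = begin
      Σ (λ k → Σ (λ l → Q j l * conj (Q k l)))   ≈⟨ Σ-comm (λ k l → Q j l * conj (Q k l)) ⟩
      Σ (λ l → Σ (λ k → Q j l * conj (Q k l)))   ≈⟨ Σ-cong (λ l → *-distribˡ-Σ (Q j l) (λ k → conj (Q k l))) ⟨
      Σ (λ l → Q j l * Σ (λ k → conj (Q k l)))
        ≈⟨ Σ-cong (λ l → trans (*-congˡ (restrictor-conj-columnSum l)) (zeroʳ (Q j l))) ⟩
      Σ {m} (const 0#)                           ≈⟨ Σ-zero {m} ⟩
      0#                                         ∎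

    projection-difference : ∀ i k → (Q ⊗ (Q *)) (suc i) (suc k) - (Q ⊗ (Q *)) zero (suc k)
                                    ≈ (tailMinusHead ⊗ (tail Q *)) i k
    projection-difference i k = begin
      Σ (λ l → Q (suc i) l * conj (Q (suc k) l)) - Σ (λ l → Q zero l * conj (Q (suc k) l))
        ≈⟨ Σ-distrib-- (λ l → Q (suc i) l * conj (Q (suc k) l)) (λ l → Q zero l * conj (Q (suc k) l)) ⟨
      Σ (λ l → Q (suc i) l * conj (Q (suc k) l) - Q zero l * conj (Q (suc k) l))
        ≈⟨ Σ-cong (λ l → [y-z]x≈yx-zx (conj (Q (suc k) l)) (Q (suc i) l) (Q zero l)) ⟨
      Σ (λ l → (Q (suc i) l - Q zero l) * conj (Q (suc k) l))
        ∎

    zeroSum-⊗-projection : ∀ (x : Row (suc m)) → Σ x ≈ 0# → (λ k → Σ (λ j → x j * (Q ⊗ (Q *)) j k)) ≐ x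
    zeroSum-⊗-projection x Σx≈0 = zeroSum-tail-≐ Σ-xP≈0 Σx≈0 tails
      where
      P : Matrix (suc m) (suc m)
      P = Q ⊗ (Q *)
      Σ-xP≈0 : Σ (λ k → Σ (λ j → x j * P j k)) ≈ 0#
      Σ-xP≈0 = begin
        Σ (λ k → Σ (λ j → x j * P j k))   ≈⟨ Σ-comm (λ k j → x j * P j k) ⟩
        Σ (λ j → Σ (λ k → x j * P j k))   ≈⟨ Σ-cong {f = λ j → x j * Σ (P j)} (λ j → *-distribˡ-Σ (x j) (P j)) ⟨
        Σ (λ j → x j * Σ (P j))
          ≈⟨ Σ-cong {f = λ j → x j * Σ (P j)} (λ j → trans (*-congˡ (projection-rowSum j)) (zeroʳ (x j))) ⟩
        Σ {suc m} (const 0#)              ≈⟨ Σ-zero {suc m} ⟩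
        0#                                ∎
      tails : ∀ k → Σ (λ j → x j * P j (suc k)) ≈ x (suc k)
      tails k = begin
        Σ (λ j → x j * P j (suc k))                            ≈⟨ Σ-*-zeroSum x (λ j → P j (suc k)) Σx≈0 ⟩
        Σ (λ i → x (suc i) * (P (suc i) (suc k) - P zero (suc k)))
          ≈⟨ Σ-cong (λ i → *-congˡ (projection-difference i k)) ⟩
        Σ (λ i → x (suc i) * (tailMinusHead ⊗ (tail Q *)) i k)
          ≈⟨ Σ-cong (λ i → *-congˡ (rightInverse⇒leftInverse adjoint-tail-⊗-tailMinusHead i k)) ⟩
        Σ (λ i → x (suc i) * δ i k)                             ≈⟨ Σ-δʳ k (tail x) ⟩
        x (suc k)                                               ∎

    zeroRowSums-⊗-projection : ∀ {p} (A : Matrix p (suc m)) → (∀ i → Σ (A i) ≈ 0#) → (A ⊗ (Q ⊗ (Q *))) ≋ A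
    zeroRowSums-⊗-projection A rowSums i = zeroSum-⊗-projection (A i) (rowSums i)

module Compression {c ℓ : Level} (R : CommutativeRing c ℓ) (ι : Involution R) where
  open Matrices R ι
  open LinearAlgebra R ι using (≋-refl; ≋-sym; ≋-trans; ⊗-cong; ⊗-congˡ; ⊗-congʳ; ⊗-assoc;
                               ⊗-identityˡ; ⊗-identityʳ; adjoint-cong; adjoint-involutive; adjoint-⊗)

  ≋-setoid : ℕ → ℕ → Setoid c ℓ
  ≋-setoid m k = record
    { Carrier       = Matrix m k
    ; _≈_           = _≋_
    ; isEquivalence = record { refl = ≋-refl ; sym = ≋-sym ; trans = ≋-trans }
    }

  module ≋-Reasoning {m k : ℕ} = SetoidReasoning (≋-setoid m k)
  open ≋-Reasoning

  IsNormal-resp-≋ : ∀ {n} {A B : Matrix n n} → A ≋ B → IsNormal A ⇔ IsNormal B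
  IsNormal-resp-≋ {A = A} {B} A≋B = mk⇔ (transport A≋B) (transport (≋-sym A≋B))
    where
    transport : ∀ {A B} → A ≋ B → IsNormal A → IsNormal B
    transport {A} {B} A≋B normal = begin
      B ⊗ (B *)   ≈⟨ ⊗-cong (≋-sym A≋B) (adjoint-cong (≋-sym A≋B)) ⟩
      A ⊗ (A *)   ≈⟨ normal ⟩
      (A *) ⊗ A   ≈⟨ ⊗-cong (adjoint-cong A≋B) A≋B ⟩
      (B *) ⊗ B   ∎

  conjugateBy : ∀ {n m} → Matrix n m → Matrix m m → Matrix n n
  conjugateBy Q X = (Q ⊗ X) ⊗ (Q *)

  module _ {n m} {Q : Matrix n m} (isometry : ((Q *) ⊗ Q) ≋ I) where

    adjoint-conjugateBy : ∀ X → (conjugateBy Q X *) ≋ conjugateBy Q (X *)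
    adjoint-conjugateBy X = begin
      ((Q ⊗ X) ⊗ (Q *)) *        ≈⟨ adjoint-⊗ (Q ⊗ X) (Q *) ⟩
      ((Q *) *) ⊗ ((Q ⊗ X) *)    ≈⟨ ⊗-cong (adjoint-involutive Q) (adjoint-⊗ Q X) ⟩
      Q ⊗ ((X *) ⊗ (Q *))        ≈⟨ ⊗-assoc Q (X *) (Q *) ⟨
      (Q ⊗ (X *)) ⊗ (Q *)        ∎

    conjugateBy-⊗ : ∀ X Y → (conjugateBy Q X ⊗ conjugateBy Q Y) ≋ conjugateBy Q (X ⊗ Y)
    conjugateBy-⊗ X Y = begin
      ((Q ⊗ X) ⊗ (Q *)) ⊗ ((Q ⊗ Y) ⊗ (Q *))    ≈⟨ ⊗-assoc (Q ⊗ X) (Q *) ((Q ⊗ Y) ⊗ (Q *)) ⟩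
      (Q ⊗ X) ⊗ ((Q *) ⊗ ((Q ⊗ Y) ⊗ (Q *)))    ≈⟨ ⊗-congˡ (Q ⊗ X) (⊗-assoc (Q *) (Q ⊗ Y) (Q *)) ⟨
      (Q ⊗ X) ⊗ (((Q *) ⊗ (Q ⊗ Y)) ⊗ (Q *))    ≈⟨ ⊗-congˡ (Q ⊗ X) (⊗-congʳ (Q *) (⊗-assoc (Q *) Q Y)) ⟨
      (Q ⊗ X) ⊗ ((((Q *) ⊗ Q) ⊗ Y) ⊗ (Q *))
        ≈⟨ ⊗-congˡ (Q ⊗ X) (⊗-congʳ (Q *) (≋-trans (⊗-congʳ Y isometry) (⊗-identityˡ Y))) ⟩
      (Q ⊗ X) ⊗ (Y ⊗ (Q *))                    ≈⟨ ⊗-assoc (Q ⊗ X) Y (Q *) ⟨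
      ((Q ⊗ X) ⊗ Y) ⊗ (Q *)                    ≈⟨ ⊗-congʳ (Q *) (⊗-assoc Q X Y) ⟩
      (Q ⊗ (X ⊗ Y)) ⊗ (Q *)                    ∎

    compress-conjugateBy : ∀ X → (((Q *) ⊗ conjugateBy Q X) ⊗ Q) ≋ X
    compress-conjugateBy X = begin
      ((Q *) ⊗ ((Q ⊗ X) ⊗ (Q *))) ⊗ Q     ≈⟨ ⊗-congʳ Q (⊗-assoc (Q *) (Q ⊗ X) (Q *)) ⟨
      (((Q *) ⊗ (Q ⊗ X)) ⊗ (Q *)) ⊗ Q     ≈⟨ ⊗-assoc ((Q *) ⊗ (Q ⊗ X)) (Q *) Q ⟩
      ((Q *) ⊗ (Q ⊗ X)) ⊗ ((Q *) ⊗ Q)     ≈⟨ ⊗-cong (⊗-assoc (Q *) Q X) (≋-sym isometry) ⟨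
      (((Q *) ⊗ Q) ⊗ X) ⊗ I               ≈⟨ ⊗-identityʳ (((Q *) ⊗ Q) ⊗ X) ⟩
      ((Q *) ⊗ Q) ⊗ X                     ≈⟨ ⊗-congʳ X isometry ⟩
      I ⊗ X                               ≈⟨ ⊗-identityˡ X ⟩
      X                                   ∎

    isNormal⇔isNormal-conjugateBy : ∀ X → IsNormal X ⇔ IsNormal (conjugateBy Q X)
    isNormal⇔isNormal-conjugateBy X = mk⇔ to from
      where
      C : Matrix n n
      C = conjugateBy Q X
      C⊗C* : (C ⊗ (C *)) ≋ conjugateBy Q (X ⊗ (X *))
      C⊗C* = ≋-trans (⊗-congˡ C (adjoint-conjugateBy X)) (conjugateBy-⊗ X (X *))
      C*⊗C : ((C *) ⊗ C) ≋ conjugateBy Q ((X *) ⊗ X)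
      C*⊗C = ≋-trans (⊗-congʳ C (adjoint-conjugateBy X)) (conjugateBy-⊗ (X *) X)
      to : IsNormal X → IsNormal C
      to normal = begin
        C ⊗ (C *)                      ≈⟨ C⊗C* ⟩
        conjugateBy Q (X ⊗ (X *))      ≈⟨ ⊗-congʳ (Q *) (⊗-congˡ Q normal) ⟩
        conjugateBy Q ((X *) ⊗ X)      ≈⟨ C*⊗C ⟨
        (C *) ⊗ C                      ∎
      from : IsNormal C → IsNormal X
      from normal = begin
        X ⊗ (X *)                                          ≈⟨ compress-conjugateBy (X ⊗ (X *)) ⟨
        ((Q *) ⊗ conjugateBy Q (X ⊗ (X *))) ⊗ Q
          ≈⟨ ⊗-congʳ Q (⊗-congˡ (Q *) (≋-trans (≋-sym C⊗C*) (≋-trans normal C*⊗C))) ⟩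
        ((Q *) ⊗ conjugateBy Q ((X *) ⊗ X)) ⊗ Q            ≈⟨ compress-conjugateBy ((X *) ⊗ X) ⟩
        (X *) ⊗ X                                          ∎

    compression-isNormal⇔ : ∀ {A : Matrix n n} → (A ⊗ (Q ⊗ (Q *))) ≋ A →
                            IsNormal (((Q *) ⊗ A) ⊗ Q) ⇔ IsNormal ((Q ⊗ (Q *)) ⊗ A)
    compression-isNormal⇔ {A} AP≋A =
      IsNormal-resp-≋ P⊗A≋ ⇔-∘ isNormal⇔isNormal-conjugateBy (((Q *) ⊗ A) ⊗ Q)
      where
      P⊗A≋ : conjugateBy Q (((Q *) ⊗ A) ⊗ Q) ≋ ((Q ⊗ (Q *)) ⊗ A)
      P⊗A≋ = begin
        (Q ⊗ (((Q *) ⊗ A) ⊗ Q)) ⊗ (Q *)          ≈⟨ ⊗-congʳ (Q *) (⊗-assoc Q ((Q *) ⊗ A) Q) ⟨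
        ((Q ⊗ ((Q *) ⊗ A)) ⊗ Q) ⊗ (Q *)          ≈⟨ ⊗-congʳ (Q *) (⊗-congʳ Q (⊗-assoc Q (Q *) A)) ⟨
        (((Q ⊗ (Q *)) ⊗ A) ⊗ Q) ⊗ (Q *)          ≈⟨ ⊗-assoc ((Q ⊗ (Q *)) ⊗ A) Q (Q *) ⟩
        ((Q ⊗ (Q *)) ⊗ A) ⊗ (Q ⊗ (Q *))          ≈⟨ ⊗-assoc (Q ⊗ (Q *)) A (Q ⊗ (Q *)) ⟩
        (Q ⊗ (Q *)) ⊗ (A ⊗ (Q ⊗ (Q *)))          ≈⟨ ⊗-congˡ (Q ⊗ (Q *)) AP≋A ⟩
        (Q ⊗ (Q *)) ⊗ A                          ∎

proposition3p8 : {c ℓ : Level} (R : CommutativeRing c ℓ) (ι : Involution R) →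
    let open Matrices R ι in
    (m : ℕ) (Γ : Digraph (suc m)) (Q : Matrix (suc m) m) → IsRestrictor Q →
    IsNormal (((Q *) ⊗ laplacian Γ) ⊗ Q) ⇔ IsNormal ((Q ⊗ (Q *)) ⊗ laplacian Γ)
proposition3p8 R ι m Γ Q isRestrictor =
  compression-isNormal⇔ orthonormal (zeroRowSums-⊗-projection isRestrictor (laplacian Γ) (laplacian-rowSum Γ))
  where
  open Matrices R ι
  open LinearAlgebra R ι using (laplacian-rowSum; zeroRowSums-⊗-projection)
  open Compression R ι using (compression-isNormal⇔)
  open IsRestrictor isRestrictor
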